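{- Let the alignment alphabet be $\{0,1\}$ and let $\pi=\#\,\_^{\,r}\,\#$ be the spaced seed consisting of two symbols $\#$ separated by $r\ge 0$ jokers $\_$ (span $m=r+2$). Then the automaton $S_\pi$ is reduced: every non-final state of $S_\pi$ is reachable from the initial state $\langle\emptyset,0\rangle$, and any two distinct non-final states $q,q'$ are non-equivalent, i.e. there is a word $u\in\{0,1\}^*$ such that exactly one of $\psi(q,u)$, $\psi(q',u)$ is the final state.
   Context: Here $\#$ denotes the subset $\{1\}$ and the joker $\_$ denotes $\{0,1\}$; a letter $a$ matches $\pi_x$ if $a\in\pi_x$. Let $m=r+2$, $R_\pi=\{i:\pi_i\neq\#\}=\{2,\dots,r+1\}$, and $\max\emptyset=0$. $\psi$ is extended to words in the usual way. The automaton $S_\pi$: its non-final states are pairs $\langle X,t\rangle$ with $X\subseteq R_\pi$, $t\in\{0,\dots,m\}$ and $\max X+t\le m-1$; there is additionally a single final state $q_F$, with every pair $\langle X,t\rangle$ satisfying $\max X+t=m$ identified with $q_F$. Initial state $\langle\emptyset,0\rangle$. Transitions: $\psi(q_F,a)=q_F$; for non-final $q=\langle X,t\rangle$, $\psi(q,1)=\langle X,t+1\rangle$ and $\psi(q,0)=\langle X_U\cup X_V,0\rangle$ with $X_U=\{x:x\le t+1,\ 0\text{ matches }\pi_x\}$ and $X_V=\{x+t+1: x\in X,\ 0\text{ matches }\pi_{x+t+1}\}$. -}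

module Defs where

open import Data.Bool using (Bool; true; false; _∧_; _∨_; if_then_else_; not)
open import Data.Nat using (ℕ; zero; suc; _+_; _∸_; _≤_; _<_; _≤ᵇ_; _<ᵇ_; _≡ᵇ_)
open import Data.Vec using (Vec; []; _∷_; replicate; tabulate)
open import Data.Fin using (Fin; toℕ)
open import Data.List using (List; foldl)
open import Data.Product using (_×_)
open import Relation.Binary.PropositionalEquality using (_≡_)

span : ℕ → ℕ
span r = r + 2

-- "0 matches π_x": π_x = _ exactly for 2 ≤ x ≤ r+1 (π_1 = π_m = # = {1}).
zeroMatches : ℕ → ℕ → Bool
zeroMatches r x = (2 ≤ᵇ x) ∧ (x ≤ᵇ suc r)

-- A set X of positions ⊆ {1..n} is a bit vector; entry i (Fin n) is position toℕ i + 1.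
PosSet : ℕ → Set
PosSet n = Vec Bool n

-- membership of a position p (p = 0 or p > n : not a member)
memAt : ∀ {n} → PosSet n → ℕ → Bool
memAt [] _ = false
memAt (b ∷ X) zero = b
memAt (b ∷ X) (suc k) = memAt X k

memPos : ∀ {n} → PosSet n → ℕ → Bool
memPos X zero = false
memPos X (suc k) = memAt X k

-- max X, with max ∅ = 0
maxPos : ∀ {n} → PosSet n → ℕ
maxPos [] = 0
maxPos (b ∷ X) with maxPos X
... | zero = if b then 1 else 0
... | suc k = suc (suc k)

emptySet : ∀ {n} → PosSet n
emptySet = replicate _ false

data State (r : ℕ) : Set where
  qF : State r
  st : PosSet (span r) → ℕ → State r

NonFinal : (r : ℕ) → PosSet (span r) → ℕ → Set
NonFinal r X t =
  (∀ p → memPos X p ≡ true → (2 ≤ p) × (p ≤ suc r)) × (t ≤ span r) × (maxPos X + t < span r)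

-- letters: true = 1, false = 0
δ : (r : ℕ) → State r → Bool → State r
δ r qF a = qF
δ r (st X t) true =
  if span r ≤ᵇ maxPos X + suc t then qF else st X (suc t)   -- max X + t = m is identified with q_F
δ r (st X t) false = st (tabulate λ i → newMem (suc (toℕ i))) 0
  where
    newMem : ℕ → Bool
    newMem p = ((p ≤ᵇ suc t) ∧ zeroMatches r p)
             ∨ ((suc t <ᵇ p) ∧ memPos X (p ∸ suc t) ∧ zeroMatches r p)

ψ : (r : ℕ) → State r → List Bool → State r
ψ r = foldl (δ r)

initial : (r : ℕ) → State r
initial r = st emptySet 0

{-# OPTIONS --safe #-}
module Submission where

-- For π = # _^r #, a non-final state ⟨X,t⟩ is just the history of the last r + 1 letters read:
-- the letter read i + 1 steps ago was a 1 iff i < t or i + 1 − t ∈ X.  Reading a letter pushes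
-- it onto this history, and reading 1 leads to q_F exactly when the letter read r + 1 steps ago
-- was a 1.  Distinct non-final states have distinct histories, so replaying the history of a
-- state from ⟨∅,0⟩ reaches it, and two states whose histories differ at position i are
-- separated by 0^(r−i) 1.

open import Defs
open import Data.Bool using (Bool; true; false; T; _∧_; _∨_; if_then_else_)
open import Data.Bool.Properties
  using (∧-assoc; ∧-distribʳ-∨; ∧-identityʳ; ∧-zeroʳ; ∧-conicalʳ; ¬-not; T-≡)
  renaming (_≟_ to _≟ᵇ_)
open import Data.Empty using (⊥-elim)
open import Data.Fin using (Fin; toℕ; fromℕ<)
open import Data.Fin.Properties using (toℕ<n; toℕ-fromℕ<; ¬∀⟶∃¬)
open import Data.List using (List; []; _∷_; _∷ʳ_; length; replicate; applyDownFrom; foldl)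
open import Data.List.Properties using (length-applyDownFrom)
open import Data.Nat using (ℕ; zero; suc; _+_; _∸_; _≤_; _<_; _≤ᵇ_; _<ᵇ_; z≤n; s≤s; z<s)
open import Data.Nat.Properties
open import Data.Product using (_×_; _,_; proj₁; proj₂; ∃; ∃₂; uncurry)
open import Data.Sum using (_⊎_; inj₁; inj₂)
open import Data.Vec using ([]; _∷_; tabulate)
open import Function using (_∘_)
open import Function.Bundles using (Equivalence)
open import Relation.Nullary using (¬_; Dec; yes; no; contradiction)
open import Relation.Nullary.Decidable using (dec-true; dec-false)
open import Relation.Binary.PropositionalEquality

-- 0-indexed, unlike the positions of X: history X t 0 is the last letter read.
history : ∀ {n} → PosSet n → ℕ → ℕ → Bool
history X zero    i       = memAt X i
history X (suc t) zero    = true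
history X (suc t) (suc i) = history X t i

push : Bool → (ℕ → Bool) → ℕ → Bool
push b g zero    = b
push b g (suc i) = g i

pushAll : (ℕ → Bool) → List Bool → ℕ → Bool
pushAll = foldl λ g b → push b g

pushAll-beyond : ∀ g u k → pushAll g u (k + length u) ≡ g k
pushAll-beyond g []      k = cong g (+-identityʳ k)
pushAll-beyond g (b ∷ u) k =
  trans (cong (pushAll (push b g) u) (+-suc k (length u))) (pushAll-beyond (push b g) u (suc k))

pushAll-applyDownFrom : ∀ g h {i j} → i < j → pushAll g (applyDownFrom h j) i ≡ h i
pushAll-applyDownFrom g h {i} {suc j} i<1+j with m≤n⇒m<n∨m≡n (≤-pred i<1+j)
... | inj₁ i<j = pushAll-applyDownFrom (push (h j) g) h i<j
... | inj₂ refl =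
  trans (cong (pushAll (push (h i) g) (applyDownFrom h i)) (sym (length-applyDownFrom h i)))
        (pushAll-beyond (push (h i) g) (applyDownFrom h i) 0)

infix 4 _≈[_]_
_≈[_]_ : (ℕ → Bool) → ℕ → (ℕ → Bool) → Set
f ≈[ n ] g = ∀ i → i ≤ n → f i ≡ g i

span≡2+ : ∀ r → span r ≡ 2 + r
span≡2+ r = +-comm r 2

memAt-emptySet : ∀ n k → memAt (emptySet {n}) k ≡ false
memAt-emptySet zero    k       = refl
memAt-emptySet (suc n) zero    = refl
memAt-emptySet (suc n) (suc k) = memAt-emptySet n k

memAt-tabulate : ∀ n (f : ℕ → Bool) k →
  memAt (tabulate {n = n} λ i → f (suc (toℕ i))) k ≡ (k <ᵇ n) ∧ f (suc k)
memAt-tabulate zero    f k       = refl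
memAt-tabulate (suc n) f zero    = refl
memAt-tabulate (suc n) f (suc k) = memAt-tabulate n (f ∘ suc) k

memAt-ext : ∀ {n} {X Y : PosSet n} → (∀ k → memAt X k ≡ memAt Y k) → X ≡ Y
memAt-ext {X = []}    {[]}    _    = refl
memAt-ext {X = a ∷ X} {b ∷ Y} same = cong₂ _∷_ (same zero) (memAt-ext (same ∘ suc))

memAt⇒<maxPos : ∀ {n} (X : PosSet n) k → memAt X k ≡ true → k < maxPos X
memAt⇒<maxPos [] k ()
memAt⇒<maxPos (b ∷ X) zero e with maxPos X
memAt⇒<maxPos (b ∷ X) zero refl | zero  = z<s
memAt⇒<maxPos (b ∷ X) zero e    | suc _ = z<s
memAt⇒<maxPos (b ∷ X) (suc k) e with maxPos X | memAt⇒<maxPos X k e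
... | suc _ | k<max = s≤s k<max

maxPos≡suc⇒memAt : ∀ {n} (X : PosSet n) k → maxPos X ≡ suc k → memAt X k ≡ true
maxPos≡suc⇒memAt [] k ()
maxPos≡suc⇒memAt (b ∷ X) k e with maxPos X in eq
maxPos≡suc⇒memAt (true ∷ X)  zero    e    | zero  = refl
maxPos≡suc⇒memAt (false ∷ X) k       ()   | zero
maxPos≡suc⇒memAt (true ∷ X)  (suc k) ()   | zero
maxPos≡suc⇒memAt (b ∷ X)     (suc k) refl | suc j = maxPos≡suc⇒memAt X j eq

maxPos-least : ∀ {n} (X : PosSet n) B → (∀ k → memAt X k ≡ true → k < B) → maxPos X ≤ B
maxPos-least X B below with maxPos X in eq
... | zero  = z≤n
... | suc k = below k (maxPos≡suc⇒memAt X k eq)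

memAt≡<ᵇmaxPos : ∀ {n} (X : PosSet n) k → maxPos X ≤ suc k → memAt X k ≡ (k <ᵇ maxPos X)
memAt≡<ᵇmaxPos X k max≤ with m≤n⇒m<n∨m≡n max≤
... | inj₂ max≡ = trans (maxPos≡suc⇒memAt X k max≡)
                       (sym (dec-true (k <? maxPos X) (≤-reflexive (sym max≡))))
... | inj₁ max< = trans (¬-not λ e → <⇒≱ (memAt⇒<maxPos X k e) (≤-pred max<))
                       (sym (dec-false (k <? maxPos X) (≤⇒≯ (≤-pred max<))))

history-within : ∀ {n} (X : PosSet n) {t i} → i < t → history X t i ≡ true
history-within X {suc t} {zero}  _         = refl
history-within X {suc t} {suc i} (s≤s i<t) = history-within X i<t

history-shift : ∀ {n} (X : PosSet n) t k → history X t (t + k) ≡ memAt X k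
history-shift X zero    k = refl
history-shift X (suc t) k = history-shift X t k

history-cmp : ∀ {n} (X : PosSet n) t i →
  history X t i ≡ (i <ᵇ t) ∨ ((t <ᵇ suc i) ∧ memPos X (suc i ∸ t))
history-cmp X zero    i       = refl
history-cmp X (suc t) zero    = refl
history-cmp X (suc t) (suc i) = history-cmp X t i

history-edge : ∀ {n} (X : PosSet n) t i → t + maxPos X ≤ suc i →
  history X t i ≡ (i <ᵇ t + maxPos X)
history-edge X zero    i       bound       = memAt≡<ᵇmaxPos X i bound
history-edge X (suc t) zero    _           = refl
history-edge X (suc t) (suc i) (s≤s bound) = history-edge X t i bound

nonFinal : ∀ {r X t} → (∀ p → memPos X p ≡ true → (2 ≤ p) × (p ≤ suc r)) → t + maxPos X ≤ suc r →
  NonFinal r X t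
nonFinal {r} {X} {t} inR bound = inR , t≤span , max+t<span
  where
  t≤span : t ≤ span r
  t≤span = subst (t ≤_) (sym (span≡2+ r)) (≤-trans (m≤m+n t (maxPos X)) (m≤n⇒m≤1+n bound))
  max+t<span : maxPos X + t < span r
  max+t<span = subst₂ _<_ (+-comm t (maxPos X)) (sym (span≡2+ r)) (s≤s bound)

nonFinal-bound : ∀ {r X t} → NonFinal r X t → t + maxPos X ≤ suc r
nonFinal-bound {r} {X} {t} (_ , _ , max+t<span) =
  ≤-pred (subst₂ _<_ (+-comm (maxPos X) t) (span≡2+ r) max+t<span)

nonFinal-emptySet : ∀ {r} → NonFinal r emptySet 0
nonFinal-emptySet {r} =
  nonFinal inR (maxPos-least (emptySet {span r}) (suc r) λ k → ⊥-elim ∘ absent k)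
  where
  absent : ∀ k → memAt (emptySet {span r}) k ≢ true
  absent k e = contradiction (trans (sym e) (memAt-emptySet (span r) k)) λ ()
  inR : ∀ p → memPos (emptySet {span r}) p ≡ true → (2 ≤ p) × (p ≤ suc r)
  inR (suc k) e = ⊥-elim (absent k e)

history-at-t : ∀ {r X t} → NonFinal r X t → history X t t ≡ false
history-at-t {X = X} {t} (inR , _) = begin
  history X t t       ≡⟨ cong (history X t) (+-identityʳ t) ⟨
  history X t (t + 0) ≡⟨ history-shift X t 0 ⟩
  memAt X 0           ≡⟨ ¬-not (λ e → <-irrefl refl (proj₁ (inR 1 e))) ⟩
  false               ∎
  where open ≡-Reasoning

memAt-beyond : ∀ {r X t} k → NonFinal r X t → r < t + k → memAt X k ≡ false
memAt-beyond {r} {X} {t} k nf r<t+k = ¬-not λ e → <⇒≱ r<t+k (≤-pred (begin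
  suc (t + k)   ≡⟨ +-suc t k ⟨
  t + suc k     ≤⟨ +-monoʳ-≤ t (memAt⇒<maxPos X k e) ⟩
  t + maxPos X  ≤⟨ nonFinal-bound nf ⟩
  suc r         ∎))
  where open ≤-Reasoning

-- X_U ∪ X_V, written exactly as in δ so that δ r (st X t) false ≡ st (afterZero r X t) 0
-- holds by refl.
memAfterZero : (r : ℕ) → PosSet (span r) → ℕ → ℕ → Bool
memAfterZero r X t p = ((p ≤ᵇ suc t) ∧ zeroMatches r p)
                     ∨ ((suc t <ᵇ p) ∧ memPos X (p ∸ suc t) ∧ zeroMatches r p)

afterZero : (r : ℕ) → PosSet (span r) → ℕ → PosSet (span r)
afterZero r X t = tabulate λ i → memAfterZero r X t (suc (toℕ i))

memAfterZero-suc : ∀ r X t i → memAfterZero r X t (suc (suc i)) ≡ history X t i ∧ (i <ᵇ r)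
memAfterZero-suc r X t i = sym (begin
  history X t i ∧ z                  ≡⟨ cong (_∧ z) (history-cmp X t i) ⟩
  (a ∨ (b ∧ c)) ∧ z                  ≡⟨ ∧-distribʳ-∨ z a (b ∧ c) ⟩
  (a ∧ z) ∨ ((b ∧ c) ∧ z)            ≡⟨ cong ((a ∧ z) ∨_) (∧-assoc b c z) ⟩
  (a ∧ z) ∨ (b ∧ (c ∧ z))            ∎)
  where
  open ≡-Reasoning
  a b c z : Bool
  a = i <ᵇ t
  b = t <ᵇ suc i
  c = memPos X (suc i ∸ t)
  z = i <ᵇ r

memAt-afterZero-zero : ∀ r X t → memAt (afterZero r X t) 0 ≡ false
memAt-afterZero-zero r X t = trans (memAt-tabulate (span r) (memAfterZero r X t) 0) (∧-zeroʳ _)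

memAt-afterZero-suc : ∀ r X t i →
  memAt (afterZero r X t) (suc i) ≡ (suc i <ᵇ span r) ∧ (history X t i ∧ (i <ᵇ r))
memAt-afterZero-suc r X t i =
  trans (memAt-tabulate (span r) (memAfterZero r X t) (suc i))
        (cong ((suc i <ᵇ span r) ∧_) (memAfterZero-suc r X t i))

memAt-afterZero⇒ : ∀ r X t k → memAt (afterZero r X t) k ≡ true → (1 ≤ k) × (k ≤ r)
memAt-afterZero⇒ r X t zero    e = contradiction (trans (sym e) (memAt-afterZero-zero r X t)) λ ()
memAt-afterZero⇒ r X t (suc i) e = s≤s z≤n , <ᵇ⇒< i r (Equivalence.from T-≡ i<ᵇr)
  where
  i<ᵇr : (i <ᵇ r) ≡ true
  i<ᵇr = ∧-conicalʳ (history X t i) _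
           (∧-conicalʳ (suc i <ᵇ span r) _ (trans (sym (memAt-afterZero-suc r X t i)) e))

history-afterZero : ∀ r X t {i} → i < r → history (afterZero r X t) 0 (suc i) ≡ history X t i
history-afterZero r X t {i} i<r = begin
  memAt (afterZero r X t) (suc i)                  ≡⟨ memAt-afterZero-suc r X t i ⟩
  (suc i <ᵇ span r) ∧ (history X t i ∧ (i <ᵇ r))   ≡⟨ cong₂ (λ x y → x ∧ (history X t i ∧ y))
                                                        (dec-true (suc i <? span r) 1+i<span)
                                                        (dec-true (i <? r) i<r) ⟩
  history X t i ∧ true                             ≡⟨ ∧-identityʳ _ ⟩
  history X t i                                    ∎
  where
  open ≡-Reasoning
  1+i<span : suc i < span r
  1+i<span = subst (suc i <_) (sym (span≡2+ r)) (m<n⇒m<1+n (s≤s i<r))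

nonFinal-afterZero : ∀ r X t → NonFinal r (afterZero r X t) 0
nonFinal-afterZero r X t =
  nonFinal inR (maxPos-least (afterZero r X t) (suc r) λ k e →
                  s≤s (proj₂ (memAt-afterZero⇒ r X t k e)))
  where
  inR : ∀ p → memPos (afterZero r X t) p ≡ true → (2 ≤ p) × (p ≤ suc r)
  inR (suc k) e with memAt-afterZero⇒ r X t k e
  ... | 1≤k , k≤r = s≤s 1≤k , s≤s k≤r

δ-one : ∀ {r X t} → NonFinal r X t →
  δ r (st X t) true ≡ (if history X t r then qF else st X (suc t))
δ-one {r} {X} {t} nf =
  cong (λ hit → if hit then qF else st X (suc t))
       (trans hitTest (sym (history-edge X t r (nonFinal-bound nf))))
  where
  hitTest : (span r ≤ᵇ maxPos X + suc t) ≡ (r <ᵇ t + maxPos X)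
  hitTest = cong₂ _≤ᵇ_ (span≡2+ r) (trans (+-suc (maxPos X) t) (cong suc (+-comm (maxPos X) t)))

nonFinal-suc : ∀ {r X t} → NonFinal r X t → history X t r ≡ false → NonFinal r X (suc t)
nonFinal-suc {r} {X} {t} nf@(inR , _) miss = nonFinal inR (s≤s (≮⇒≥ r≮t+max))
  where
  r≮t+max : ¬ r < t + maxPos X
  r≮t+max r<t+max =
    subst T (trans (sym (history-edge X t r (nonFinal-bound nf))) miss) (<⇒<ᵇ r<t+max)

Remembers : (r : ℕ) → State r → (ℕ → Bool) → Set
Remembers r q g = ∃₂ λ X t → q ≡ st X t × NonFinal r X t × history X t ≈[ r ] g

remembers-δ : ∀ {r q g} b → Remembers r q g → (b ≡ true → g r ≡ false) →
  Remembers r (δ r q b) (push b g)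
remembers-δ {r} false (X , t , refl , _ , X≈g) _ =
  afterZero r X t , 0 , refl , nonFinal-afterZero r X t , λ where
    zero    _   → memAt-afterZero-zero r X t
    (suc i) i<r → trans (history-afterZero r X t i<r) (X≈g i (<⇒≤ i<r))
remembers-δ {r} true (X , t , refl , nf , X≈g) noHit =
  X , suc t , trans (δ-one nf) (cong (λ hit → if hit then qF else st X (suc t)) miss) ,
  nonFinal-suc nf miss , λ where
    zero    _   → refl
    (suc i) i<r → X≈g i (<⇒≤ i<r)
  where
  miss : history X t r ≡ false
  miss = trans (X≈g r ≤-refl) (noHit refl)

-- The side condition says that every remembered letter reaching position r while u is read is
-- a 0, so no letter of u leads to q_F.
remembers-ψ : ∀ {r q g} u → length u ≤ suc r → Remembers r q g →
  (∀ i → i ≤ r → r < i + length u → g i ≡ false) → Remembers r (ψ r q u) (pushAll g u)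
remembers-ψ []      _     rem _   = rem
remembers-ψ {r} {g = g} (b ∷ u) 1+u≤1+r rem old =
  remembers-ψ u (<⇒≤ 1+u≤1+r) (remembers-δ b rem noHit) old′
  where
  noHit : b ≡ true → g r ≡ false
  noHit _ = old r ≤-refl (m<m+n r z<s)
  old′ : ∀ i → i ≤ r → r < i + length u → push b g i ≡ false
  old′ zero    _   r<u   = contradiction r<u (≤⇒≯ (≤-pred 1+u≤1+r))
  old′ (suc i) i<r r<1+i+u = old i (<⇒≤ i<r) (subst (r <_) (sym (+-suc i (length u))) r<1+i+u)

history-injectiveᵗ : ∀ {r X t X′ t′} → NonFinal r X t → NonFinal r X′ t′ →
  history X t ≈[ r ] history X′ t′ → t ≡ t′
history-injectiveᵗ nf nf′ same =
  ≤-antisym (≮⇒≥ (noLag nf′ nf λ i i≤r → sym (same i i≤r))) (≮⇒≥ (noLag nf nf′ same))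
  where
  noLag : ∀ {r X t X′ t′} → NonFinal r X t → NonFinal r X′ t′ →
    history X t ≈[ r ] history X′ t′ → ¬ t < t′
  noLag {r} {X} {t} {X′} {t′} nf nf′ same t<t′ =
    contradiction (trans (sym (history-at-t nf)) (trans (same t t≤r) (history-within X′ t<t′))) λ ()
    where
    t≤r : t ≤ r
    t≤r = ≤-pred (≤-trans t<t′ (m+n≤o⇒m≤o t′ (nonFinal-bound nf′)))

history-injectiveˣ : ∀ {r X X′ t} → NonFinal r X t → NonFinal r X′ t →
  history X t ≈[ r ] history X′ t → X ≡ X′
history-injectiveˣ {r} {X} {X′} {t} nf nf′ same = memAt-ext memAt-agree
  where
  memAt-agree : ∀ k → memAt X k ≡ memAt X′ k
  memAt-agree k with t + k ≤? r
  ... | yes t+k≤r =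
    trans (sym (history-shift X t k)) (trans (same (t + k) t+k≤r) (history-shift X′ t k))
  ... | no  t+k≰r = trans (memAt-beyond k nf (≰⇒> t+k≰r)) (sym (memAt-beyond k nf′ (≰⇒> t+k≰r)))

history-injective : ∀ {r X t X′ t′} → NonFinal r X t → NonFinal r X′ t′ →
  history X t ≈[ r ] history X′ t′ → (X , t) ≡ (X′ , t′)
history-injective nf nf′ same with refl ← history-injectiveᵗ nf nf′ same =
  cong (_, _) (history-injectiveˣ nf nf′ same)

remembers-history : ∀ {r X t} → NonFinal r X t → Remembers r (st X t) (history X t)
remembers-history {X = X} {t} nf = X , t , refl , nf , λ _ _ → refl

remembers-unique : ∀ {r q g X t} → NonFinal r X t → Remembers r q g → g ≈[ r ] history X t →
  q ≡ st X t
remembers-unique nf (Y , s , refl , nfY , Y≈g) g≈X =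
  cong (uncurry st) (history-injective nfY nf λ i i≤r → trans (Y≈g i i≤r) (g≈X i i≤r))

reachable : ∀ {r X t} → NonFinal r X t → ∃ λ u → ψ r (initial r) u ≡ st X t
reachable {r} {X} {t} nf = replay , remembers-unique nf remembersReplay λ i i≤r →
  pushAll-applyDownFrom (λ _ → false) (history X t) (s≤s i≤r)
  where
  replay : List Bool
  replay = applyDownFrom (history X t) (suc r)
  remembersReplay : Remembers r (ψ r (initial r) replay) (pushAll (λ _ → false) replay)
  remembersReplay =
    remembers-ψ replay (≤-reflexive (length-applyDownFrom (history X t) (suc r)))
      (emptySet , 0 , refl , nonFinal-emptySet , λ i _ → memAt-emptySet (span r) i) (λ _ _ _ → refl)

isFinal : ∀ {r} → State r → Bool
isFinal qF       = true
isFinal (st _ _) = false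

isFinal-if : ∀ {r} b (X : PosSet (span r)) s → isFinal (if b then qF else st X s) ≡ b
isFinal-if true  X s = refl
isFinal-if false X s = refl

isFinal-probe : ∀ {r q g} k → k ≤ r → Remembers r q g →
  isFinal (ψ r q (replicate k false ∷ʳ true)) ≡ g (r ∸ k)
isFinal-probe {r} zero _ (X , t , refl , nf , X≈g) =
  trans (cong isFinal (δ-one nf)) (trans (isFinal-if (history X t r) X (suc t)) (X≈g r ≤-refl))
isFinal-probe {r} {g = g} (suc k) k<r rem =
  trans (isFinal-probe k (<⇒≤ k<r) (remembers-δ false rem λ ()))
        (cong (push false g) (+-∸-assoc 1 k<r))

isFinal-separates : ∀ {r} (q q′ : State r) → isFinal q ≢ isFinal q′ →
  (q ≡ qF × q′ ≢ qF) ⊎ (q ≢ qF × q′ ≡ qF)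
isFinal-separates qF       qF       differ = contradiction refl differ
isFinal-separates qF       (st _ _) _      = inj₁ (refl , λ ())
isFinal-separates (st _ _) qF       _      = inj₂ ((λ ()) , refl)
isFinal-separates (st _ _) (st _ _) differ = contradiction refl differ

distinguishable : ∀ {r X t X′ t′} → NonFinal r X t → NonFinal r X′ t′ → (X , t) ≢ (X′ , t′) →
  ∃ λ u → (ψ r (st X t) u ≡ qF × ψ r (st X′ t′) u ≢ qF)
        ⊎ (ψ r (st X t) u ≢ qF × ψ r (st X′ t′) u ≡ qF)
distinguishable {r} {X} {t} {X′} {t′} nf nf′ distinct
  with ¬∀⟶∃¬ (suc r) Agree agree? notAllAgree
  where
  Agree : Fin (suc r) → Set
  Agree i = history X t (toℕ i) ≡ history X′ t′ (toℕ i)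
  agree? : ∀ i → Dec (Agree i)
  agree? i = history X t (toℕ i) ≟ᵇ history X′ t′ (toℕ i)
  notAllAgree : ¬ (∀ i → Agree i)
  notAllAgree all = distinct (history-injective nf nf′ λ i i≤r →
    subst (λ j → history X t j ≡ history X′ t′ j) (toℕ-fromℕ< (s≤s i≤r)) (all (fromℕ< (s≤s i≤r))))
... | i , disagree = probe , isFinal-separates _ _ λ same →
  disagree (trans (sym (probes (remembers-history nf)))
                  (trans same (probes (remembers-history nf′))))
  where
  i≤r : toℕ i ≤ r
  i≤r = ≤-pred (toℕ<n i)
  probe : List Bool
  probe = replicate (r ∸ toℕ i) false ∷ʳ true
  probes : ∀ {q g} → Remembers r q g → isFinal (ψ r q probe) ≡ g (toℕ i)
  probes {g = g} rem =
    trans (isFinal-probe (r ∸ toℕ i) (m∸n≤m r (toℕ i)) rem) (cong g (m∸[m∸n]≡n i≤r))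

lemma5 : (r : ℕ) →
    (∀ X t → NonFinal r X t → ∃ λ (u : List Bool) → ψ r (initial r) u ≡ st X t)
    × (∀ X t X′ t′ → NonFinal r X t → NonFinal r X′ t′ → (X , t) ≢ (X′ , t′) →
        ∃ λ (u : List Bool) →
          ((ψ r (st X t) u ≡ qF) × ¬ (ψ r (st X′ t′) u ≡ qF))
          ⊎ (¬ (ψ r (st X t) u ≡ qF) × (ψ r (st X′ t′) u ≡ qF)))
lemma5 r = (λ X t → reachable) , (λ X t X′ t′ → distinguishable)
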